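{- Let $\mathcal{H}$ be a hypergraph and $e$ an edge of $\mathcal{H}$, and let $\mathcal{H}-e$ be the hypergraph with vertex set $V(\mathcal{H})$ and edge set $E(\mathcal{H})\setminus\{e\}$. Then $\gamma_{P_I}(\mathcal{H})-1\le\gamma_{P_I}(\mathcal{H}-e)\le\gamma_{P_I}(\mathcal{H})+|e|-1$. Moreover, both bounds are tight: each is attained with equality for some hypergraph $\mathcal{H}$ and edge $e$.
   Context: A hypergraph $\mathcal{H}=(V,E)$ has finite vertex set $V$ and edges nonempty subsets of $V$; hypergraphs are reduced (no edge is contained in another distinct edge). $N[a]=\bigcup_{a\in e\in E}e$ (so an isolated vertex $a$ has $N[a]=\{a\}$). Infectious power domination: given $S_0\subseteq V$, set $S=\bigcup_{v\in S_0}N[v]$; then while some nonempty $A\subseteq S$ and edge $e$ satisfy $A\subseteq e$ and [every vertex $v\notin S$ such that $A\cup\{v\}$ is contained in some edge lies in $e$], add the vertices of $e$ to $S$. $S_0$ is an infectious power dominating set if $S=V$ at termination; $\gamma_{P_I}(\mathcal{H})$ is the minimum size of one. -}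

module Defs where

open import Data.Nat using (ℕ; _+_; _≤_)
open import Data.Fin using (Fin)
open import Data.Fin.Subset using (Subset; _∈_; _∉_; _⊆_; _∪_; _∩_; ⊤; ∣_∣; Nonempty)
open import Data.Fin.Subset.Properties using (nonempty?)
open import Data.Bool using (Bool)
import Data.Bool.Properties as BoolP
open import Data.Vec.Properties using (≡-dec)
open import Data.List using (List; []; _∷_; filter)
open import Data.List.Relation.Unary.All using (All)
open import Data.List.Membership.Propositional using () renaming (_∈_ to _∈ₗ_)
open import Data.Product using (Σ; ∃; _×_; _,_)
open import Relation.Nullary using (¬_; yes; no)
open import Relation.Nullary.Decidable using (¬?)
open import Relation.Binary.PropositionalEquality using (_≡_)
open import Relation.Binary.Construct.Closure.ReflexiveTransitive using (Star)

-- A hypergraph on vertex set Fin n is given by its list of edges (subsets of Fin n).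
-- The edge SET is the set of list entries.
EdgeList : ℕ → Set
EdgeList n = List (Subset n)

IsHypergraph : ∀ {n} → EdgeList n → Set
IsHypergraph E =
  All Nonempty E ×
  (∀ {e f} → e ∈ₗ E → f ∈ₗ E → e ⊆ f → e ≡ f)

removeEdge : ∀ {n} → EdgeList n → Subset n → EdgeList n
removeEdge E e = filter (λ f → ¬? (≡-dec BoolP._≟_ f e)) E

-- Closed neighbourhood of a set: N[S0] = S0 ∪ ⋃ { e ∈ E | e meets S0 }
-- (= ⋃_{v ∈ S0} N[v], with N[v] = {v} ∪ ⋃_{v ∈ e} e).
closedNbhd : ∀ {n} → EdgeList n → Subset n → Subset n
closedNbhd [] S0 = S0
closedNbhd (e ∷ E) S0 with nonempty? (e ∩ S0)
... | yes _ = e ∪ closedNbhd E S0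
... | no  _ = closedNbhd E S0

Step : ∀ {n} → EdgeList n → Subset n → Subset n → Set
Step {n} E S S′ =
  Σ (Subset n) λ A → Σ (Subset n) λ e →
    Nonempty A × A ⊆ S × e ∈ₗ E × A ⊆ e ×
    (∀ (v : Fin n) → v ∉ S →
       (Σ (Subset n) λ f → f ∈ₗ E × A ⊆ f × v ∈ f) → v ∈ e) ×
    S′ ≡ S ∪ e

-- S0 is an infectious power dominating set: the process started at N[S0]
-- can reach the full vertex set. (The final set of the process is independent
-- of the order of steps, since the step condition is monotone in S.)
IsIPDS : ∀ {n} → EdgeList n → Subset n → Set
IsIPDS E S0 = Star (Step E) (closedNbhd E S0) ⊤

IsGammaPI : ∀ {n} → EdgeList n → ℕ → Set
IsGammaPI {n} E k =
  (Σ (Subset n) λ S0 → IsIPDS E S0 × ∣ S0 ∣ ≡ k) ×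
  (∀ (S0 : Subset n) → IsIPDS E S0 → k ≤ ∣ S0 ∣)

module Submission where

-- Everything rests on one transfer principle (transferRun): if two edge lists
-- differ only in edges lying inside a set X, then a successful run of one
-- started from S yields a successful run of the other started from any
-- T ⊇ S ∪ X, because a step through an edge inside X adds nothing, and an edge
-- inside X never witnesses an uninfected vertex.
--  * Lower bound: if S₀′ dominates H - e and w ∈ e, then S₀′ ∪ {w} dominates H,
--    since its neighbourhood in H already contains e.
--  * Upper bound: if S₀ dominates H, then S₀ ∪ (e - u) dominates H - e for a
--    suitable u ∈ e: take u ∈ S₀ ∩ e if there is one; otherwise follow the run
--    in H until it first reaches a vertex u of e (no earlier step can use e),
--    after which e - u completes e and the transfer principle applies.
-- Tightness is shown by two explicit hypergraphs; their minimality claims are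
-- certified by "stalled" sets, sets closed under propagation that a run from
-- inside can never leave, checked by a decision procedure.

open import Defs
open import Data.Nat using (ℕ; suc; _+_; _≤_; z≤n; s≤s)
open import Data.Nat.Properties
  using (≤-trans; ≤-reflexive; <-irrefl; ≤-pred; n≤1+n; +-suc; +-assoc; +-comm; +-monoʳ-≤; +-monoˡ-≤; ≰⇒>; _≤?_; module ≤-Reasoning)
open import Data.Fin using (Fin; zero; suc; #_; _≟_)
open import Data.Fin.Properties using (all?)
open import Data.Fin.Subset using (Subset; _∈_; _∉_; _⊆_; _∪_; _∩_; _-_; ∁; ⊤; ⊥; ⁅_⁆; ∣_∣; Nonempty; Empty)
open import Data.Fin.Subset.Properties
  using ( nonempty?; _⊆?_; _∈?_; ∈⊤; ⊆⊤; ∉⊥; ⊆-antisym; Empty-unique; x∈⁅x⁆; x∈⁅y⁆⇒x≡y; ∣⁅x⁆∣≡1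
        ; p⊆q⇒∣p∣≤∣q∣; p⊆p∪q; q⊆p∪q; x∈p∪q⁻; x∈p∩q⁺; x∈p∩q⁻; x∈p∧x≢y⇒x∈p-y; x∈p⇒∣p-x∣<∣p∣; x∈∁p⇒x∉p )
open import Data.Bool using (true; false)
import Data.Bool.Properties as Bool
open import Data.Vec using ([]; _∷_; lookup)
open import Data.Vec.Properties using (≡-dec)
open import Data.List using (List; []; _∷_; foldr)
open import Data.List.Relation.Unary.All as All using (All)
open import Data.List.Relation.Unary.Any using (Any; any?; here; there)
open import Data.List.Membership.Propositional using (find) renaming (_∈_ to _∈ₗ_)
open import Data.List.Membership.Propositional.Properties using (∈-filter⁺; ∈-filter⁻)
open import Data.Product using (Σ; _×_; _,_; proj₁; proj₂)
open import Data.Sum using (_⊎_; inj₁; inj₂; [_,_]′)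
open import Data.Empty using (⊥-elim)
open import Data.Unit using (tt)
open import Function using (_∘_)
open import Relation.Nullary using (¬_; yes; no; Dec)
open import Relation.Nullary.Decidable using (¬?; toWitness; _×-dec_; _⊎-dec_; _→-dec_)
open import Relation.Binary.PropositionalEquality using (_≡_; refl; sym; subst; cong)
open import Relation.Binary.Construct.Closure.ReflexiveTransitive using (Star; ε; _◅_)

∣p∪q∣≤∣p∣+∣q∣ : ∀ {n} (p q : Subset n) → ∣ p ∪ q ∣ ≤ ∣ p ∣ + ∣ q ∣
∣p∪q∣≤∣p∣+∣q∣ []          []          = z≤n
∣p∪q∣≤∣p∣+∣q∣ (true ∷ p)  (true ∷ q)  = s≤s (≤-trans (∣p∪q∣≤∣p∣+∣q∣ p q) (+-monoʳ-≤ ∣ p ∣ (n≤1+n ∣ q ∣)))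
∣p∪q∣≤∣p∣+∣q∣ (true ∷ p)  (false ∷ q) = s≤s (∣p∪q∣≤∣p∣+∣q∣ p q)
∣p∪q∣≤∣p∣+∣q∣ (false ∷ p) (true ∷ q)  = ≤-trans (s≤s (∣p∪q∣≤∣p∣+∣q∣ p q)) (≤-reflexive (sym (+-suc ∣ p ∣ ∣ q ∣)))
∣p∪q∣≤∣p∣+∣q∣ (false ∷ p) (false ∷ q) = ∣p∪q∣≤∣p∣+∣q∣ p q

module _ {n : ℕ} where

  ∪-least : {X Y Z : Subset n} → X ⊆ Z → Y ⊆ Z → X ∪ Y ⊆ Z
  ∪-least {X} {Y} X⊆Z Y⊆Z x∈ = [ X⊆Z , Y⊆Z ]′ (x∈p∪q⁻ X Y x∈)

  ∪-monoˡ : {X Y Z : Subset n} → X ⊆ Z → X ∪ Y ⊆ Z ∪ Y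
  ∪-monoˡ {Y = Y} {Z} X⊆Z = ∪-least (p⊆p∪q Y ∘ X⊆Z) (q⊆p∪q Z Y)

  meets-mono : {g X Y : Subset n} → Nonempty (g ∩ X) → X ⊆ Y → Nonempty (g ∩ Y)
  meets-mono {g} {X} (x , x∈) X⊆Y =
    x , x∈p∩q⁺ (proj₁ (x∈p∩q⁻ g X x∈) , X⊆Y (proj₂ (x∈p∩q⁻ g X x∈)))

  meets-sym : {X Y : Subset n} → Nonempty (X ∩ Y) → Nonempty (Y ∩ X)
  meets-sym {X} {Y} (x , x∈) = x , x∈p∩q⁺ (proj₂ (x∈p∩q⁻ X Y x∈) , proj₁ (x∈p∩q⁻ X Y x∈))

  ⊆-∪-minus : {S e : Subset n} {u : Fin n} → u ∈ S → e ⊆ S ∪ (e - u)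
  ⊆-∪-minus {S} {e} {u} u∈S {x} x∈e with x ≟ u
  ... | yes refl = p⊆p∪q (e - u) u∈S
  ... | no x≢u   = q⊆p∪q S (e - u) (x∈p∧x≢y⇒x∈p-y x∈e x≢u)

  ∣p∪⁅x⁆∣≤∣p∣+1 : (p : Subset n) (x : Fin n) → ∣ p ∪ ⁅ x ⁆ ∣ ≤ ∣ p ∣ + 1
  ∣p∪⁅x⁆∣≤∣p∣+1 p x = subst (λ k → ∣ p ∪ ⁅ x ⁆ ∣ ≤ ∣ p ∣ + k) (∣⁅x⁆∣≡1 x) (∣p∪q∣≤∣p∣+∣q∣ p ⁅ x ⁆)

  ∣p∪[q-x]∣<∣p∣+∣q∣ : (p q : Subset n) {x : Fin n} → x ∈ q → ∣ p ∪ (q - x) ∣ + 1 ≤ ∣ p ∣ + ∣ q ∣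
  ∣p∪[q-x]∣<∣p∣+∣q∣ p q {x} x∈q = begin
    ∣ p ∪ (q - x) ∣ + 1    ≤⟨ +-monoˡ-≤ 1 (∣p∪q∣≤∣p∣+∣q∣ p (q - x)) ⟩
    ∣ p ∣ + ∣ q - x ∣ + 1  ≡⟨ +-assoc ∣ p ∣ ∣ q - x ∣ 1 ⟩
    ∣ p ∣ + (∣ q - x ∣ + 1) ≡⟨ cong (∣ p ∣ +_) (+-comm ∣ q - x ∣ 1) ⟩
    ∣ p ∣ + suc ∣ q - x ∣  ≤⟨ +-monoʳ-≤ ∣ p ∣ (x∈p⇒∣p-x∣<∣p∣ x∈q) ⟩
    ∣ p ∣ + ∣ q ∣          ∎
    where open ≤-Reasoning

  ⁅⁆⊆ : {x : Fin n} {p : Subset n} → x ∈ p → ⁅ x ⁆ ⊆ p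
  ⁅⁆⊆ {x} {p} x∈p y∈ = subst (_∈ p) (sym (x∈⁅y⁆⇒x≡y x y∈)) x∈p

  ∈⇒1≤∣∣ : {x : Fin n} {p : Subset n} → x ∈ p → 1 ≤ ∣ p ∣
  ∈⇒1≤∣∣ {x} x∈p = subst (_≤ _) (∣⁅x⁆∣≡1 x) (p⊆q⇒∣p∣≤∣q∣ (⁅⁆⊆ x∈p))

  -- A set with at most one element lies inside some singleton
  -- (x₀ serves as the singleton for the empty set).
  ⊆-singleton : (x₀ : Fin n) (p : Subset n) → ∣ p ∣ ≤ 1 → Σ (Fin n) λ x → p ⊆ ⁅ x ⁆
  ⊆-singleton x₀ p ∣p∣≤1 with nonempty? p
  ... | no empty      = x₀ , λ y∈p → ⊥-elim (empty (_ , y∈p))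
  ... | yes (x , x∈p) = x , only-x
    where
    only-x : p ⊆ ⁅ x ⁆
    only-x {y} y∈p with y ≟ x
    ... | yes refl = x∈⁅x⁆ x
    ... | no y≢x   = ⊥-elim (<-irrefl refl
          (≤-trans (x∈p⇒∣p-x∣<∣p∣ x∈p) (≤-trans ∣p∣≤1 (∈⇒1≤∣∣ (x∈p∧x≢y⇒x∈p-y y∈p y≢x)))))

module _ {n : ℕ} where

  ⊆-closedNbhd : (E : EdgeList n) (X : Subset n) → X ⊆ closedNbhd E X
  ⊆-closedNbhd []      X x∈ = x∈
  ⊆-closedNbhd (g ∷ E) X x∈ with nonempty? (g ∩ X)
  ... | yes _ = q⊆p∪q g _ (⊆-closedNbhd E X x∈)
  ... | no  _ = ⊆-closedNbhd E X x∈

  edge⊆closedNbhd : {E : EdgeList n} {X g : Subset n} → g ∈ₗ E → Nonempty (g ∩ X) → g ⊆ closedNbhd E X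
  edge⊆closedNbhd {g ∷ E} {X} (here refl) meets x∈ with nonempty? (g ∩ X)
  ... | yes _    = p⊆p∪q _ x∈
  ... | no apart = ⊥-elim (apart meets)
  edge⊆closedNbhd {h ∷ E} {X} (there g∈) meets x∈ with nonempty? (h ∩ X)
  ... | yes _ = q⊆p∪q h _ (edge⊆closedNbhd g∈ meets x∈)
  ... | no  _ = edge⊆closedNbhd g∈ meets x∈

  closedNbhd-least : (E : EdgeList n) {X Y : Subset n} → X ⊆ Y →
                     (∀ {g} → g ∈ₗ E → Nonempty (g ∩ X) → g ⊆ Y) → closedNbhd E X ⊆ Y
  closedNbhd-least []      X⊆Y edges⊆Y = X⊆Y
  closedNbhd-least (g ∷ E) {X} X⊆Y edges⊆Y with nonempty? (g ∩ X)
  ... | yes meets = ∪-least (edges⊆Y (here refl) meets) (closedNbhd-least E X⊆Y (edges⊆Y ∘ there))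
  ... | no  _     = closedNbhd-least E X⊆Y (edges⊆Y ∘ there)

  closedNbhd-transfer : {F G : EdgeList n} {X Y : Subset n} → X ⊆ Y →
                        (∀ {g} → g ∈ₗ F → Nonempty (g ∩ X) → g ∈ₗ G ⊎ g ⊆ Y) →
                        closedNbhd F X ⊆ closedNbhd G Y
  closedNbhd-transfer {F} {G} {X} {Y} X⊆Y edgeOk =
    closedNbhd-least F (⊆-closedNbhd G Y ∘ X⊆Y) edge⊆
    where
    edge⊆ : ∀ {g} → g ∈ₗ F → Nonempty (g ∩ X) → g ⊆ closedNbhd G Y
    edge⊆ g∈ meets with edgeOk g∈ meets
    ... | inj₁ g∈G = edge⊆closedNbhd g∈G (meets-mono meets X⊆Y)
    ... | inj₂ g⊆Y = ⊆-closedNbhd G Y ∘ g⊆Y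

module _ {n : ℕ} where

  Forced : EdgeList n → Subset n → Subset n → Subset n → Set
  Forced E S A f = ∀ (v : Fin n) → v ∉ S → (Σ (Subset n) λ g → g ∈ₗ E × A ⊆ g × v ∈ g) → v ∈ f

  -- A step remains valid from a larger infected set and in an edge list G whose
  -- extra edges lie inside the larger set, since such edges cannot witness
  -- an uninfected vertex.
  liftStep : {F G : EdgeList n} {S T A f : Subset n} →
             (∀ {g} → g ∈ₗ G → g ∈ₗ F ⊎ g ⊆ T) → S ⊆ T →
             Nonempty A → A ⊆ S → f ∈ₗ G → A ⊆ f → Forced F S A f → Step G T (T ∪ f)
  liftStep {T = T} {A} {f} G⊆F S⊆T A≠∅ A⊆S f∈G A⊆f forced =
    A , f , A≠∅ , S⊆T ∘ A⊆S , f∈G , A⊆f , forced′ , refl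
    where
    forced′ : Forced _ T A f
    forced′ v v∉T (g , g∈G , A⊆g , v∈g) with G⊆F g∈G
    ... | inj₁ g∈F = forced v (v∉T ∘ S⊆T) (g , g∈F , A⊆g , v∈g)
    ... | inj₂ g⊆T = ⊥-elim (v∉T (g⊆T v∈g))

  finished : {E : EdgeList n} {T : Subset n} → ⊤ ⊆ T → Star (Step E) T ⊤
  finished ⊤⊆T = subst (λ U → Star (Step _) U ⊤) (⊆-antisym ⊤⊆T ⊆⊤) ε

  transferRun : {F G : EdgeList n} {X S T : Subset n} →
                (∀ {g} → g ∈ₗ F → g ∈ₗ G ⊎ g ⊆ X) → (∀ {g} → g ∈ₗ G → g ∈ₗ F ⊎ g ⊆ X) →
                S ⊆ T → X ⊆ T → Star (Step F) S ⊤ → Star (Step G) T ⊤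
  transferRun F⊆G G⊆F S⊆T X⊆T ε = finished S⊆T
  transferRun {X = X} {T = T} F⊆G G⊆F S⊆T X⊆T ((A , f , A≠∅ , A⊆S , f∈F , A⊆f , forced , refl) ◅ run)
    with F⊆G f∈F
  ... | inj₁ f∈G = liftStep G⊆F′ S⊆T A≠∅ A⊆S f∈G A⊆f forced
                     ◅ transferRun F⊆G G⊆F (∪-monoˡ S⊆T) (p⊆p∪q f ∘ X⊆T) run
    where
    G⊆F′ : ∀ {g} → g ∈ₗ _ → g ∈ₗ _ ⊎ g ⊆ T
    G⊆F′ g∈ with G⊆F g∈
    ... | inj₁ g∈F = inj₁ g∈F
    ... | inj₂ g⊆X = inj₂ (X⊆T ∘ g⊆X)
  ... | inj₂ f⊆X = transferRun F⊆G G⊆F (∪-least S⊆T (X⊆T ∘ f⊆X)) X⊆T run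

module Removal {n : ℕ} (E : EdgeList n) (e : Subset n) where

  E′ : EdgeList n
  E′ = removeEdge E e

  kept : ∀ {g} → g ∈ₗ E′ → g ∈ₗ E
  kept g∈ = proj₁ (∈-filter⁻ (λ f → ¬? (≡-dec Bool._≟_ f e)) g∈)

  removedOrKept : ∀ {g} → g ∈ₗ E → g ≡ e ⊎ g ∈ₗ E′
  removedOrKept {g} g∈ with ≡-dec Bool._≟_ g e
  ... | yes g≡e = inj₁ g≡e
  ... | no  g≢e = inj₂ (∈-filter⁺ (λ f → ¬? (≡-dec Bool._≟_ f e)) g∈ g≢e)

  E⊆E′ : ∀ {g} → g ∈ₗ E → g ∈ₗ E′ ⊎ g ⊆ e
  E⊆E′ g∈ with removedOrKept g∈
  ... | inj₁ refl = inj₂ (λ x∈ → x∈)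
  ... | inj₂ g∈′  = inj₁ g∈′

  E′⊆E : ∀ {g} → g ∈ₗ E′ → g ∈ₗ E ⊎ g ⊆ e
  E′⊆E = inj₁ ∘ kept

  -- Follow a successful run in E until it first infects some u ∈ e.  Up to that
  -- point no step uses e (its trigger would already meet e), so the same steps
  -- are valid in E′; afterwards adding e - u completes e and transferRun applies.
  runWithout : Nonempty e → {S : Subset n} → Star (Step E) S ⊤ →
               Σ (Fin n) λ u → u ∈ e × (∀ T → S ⊆ T → e - u ⊆ T → Star (Step E′) T ⊤)
  runWithout e≠∅ {S} run with nonempty? (S ∩ e)
  ... | yes (u , u∈S∩e) = u , proj₂ (x∈p∩q⁻ S e u∈S∩e) , λ T S⊆T e-u⊆T →
          transferRun E⊆E′ E′⊆E S⊆T (∪-least S⊆T e-u⊆T ∘ e⊆S∪[e-u]) run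
    where
    e⊆S∪[e-u] : e ⊆ S ∪ (e - u)
    e⊆S∪[e-u] = ⊆-∪-minus (proj₁ (x∈p∩q⁻ S e u∈S∩e))
  runWithout (u , u∈e) ε | no apart = ⊥-elim (apart (u , x∈p∩q⁺ (∈⊤ , u∈e)))
  runWithout e≠∅ ((A , f , (a , a∈A) , A⊆S , f∈E , A⊆f , forced , refl) ◅ run) | no apart
    with removedOrKept f∈E
  ... | inj₁ refl = ⊥-elim (apart (a , x∈p∩q⁺ (A⊆S a∈A , A⊆f a∈A)))
  ... | inj₂ f∈E′ with runWithout e≠∅ run
  ...   | u , u∈e , rest = u , u∈e , λ T S⊆T e-u⊆T →
            liftStep (inj₁ ∘ kept) S⊆T (a , a∈A) A⊆S f∈E′ A⊆f forced
              ◅ rest (T ∪ f) (∪-monoˡ S⊆T) (p⊆p∪q f ∘ e-u⊆T)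

  addVertex : e ∈ₗ E → {w : Fin n} → w ∈ e → {S₀ : Subset n} → IsIPDS E′ S₀ → IsIPDS E (S₀ ∪ ⁅ w ⁆)
  addVertex e∈E {w} w∈e {S₀} dom =
    transferRun E′⊆E E⊆E′ (closedNbhd-transfer (p⊆p∪q ⁅ w ⁆) (λ g∈ _ → inj₁ (kept g∈)))
      (edge⊆closedNbhd e∈E (w , x∈p∩q⁺ (w∈e , q⊆p∪q S₀ ⁅ w ⁆ (x∈⁅x⁆ w)))) dom

  closedNbhd-removal : {S₀ Y : Subset n} → S₀ ⊆ Y → (Nonempty (e ∩ S₀) → e ⊆ Y) →
                       closedNbhd E S₀ ⊆ closedNbhd E′ Y
  closedNbhd-removal S₀⊆Y e⊆Y = closedNbhd-transfer S₀⊆Y edgeOk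
    where
    edgeOk : ∀ {g} → g ∈ₗ E → Nonempty (g ∩ _) → g ∈ₗ E′ ⊎ g ⊆ _
    edgeOk g∈ meets with removedOrKept g∈
    ... | inj₁ refl = inj₂ (e⊆Y meets)
    ... | inj₂ g∈′  = inj₁ g∈′

  addEdgeButOne : Nonempty e → {S₀ : Subset n} → IsIPDS E S₀ →
                  Σ (Fin n) λ u → u ∈ e × IsIPDS E′ (S₀ ∪ (e - u))
  addEdgeButOne e≠∅ {S₀} dom with nonempty? (S₀ ∩ e)
  ... | yes (u , u∈S₀∩e) = u , proj₂ (x∈p∩q⁻ S₀ e u∈S₀∩e) ,
          transferRun E⊆E′ E′⊆E (closedNbhd-removal (p⊆p∪q _) (λ _ → e⊆Y)) (⊆-closedNbhd E′ _ ∘ e⊆Y) dom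
    where
    e⊆Y : e ⊆ S₀ ∪ (e - u)
    e⊆Y = ⊆-∪-minus (proj₁ (x∈p∩q⁻ S₀ e u∈S₀∩e))
  ... | no apart with runWithout e≠∅ dom
  ...   | u , u∈e , rest = u , u∈e ,
          rest _ (closedNbhd-removal (p⊆p∪q _) (⊥-elim ∘ apart ∘ meets-sym))
                 (⊆-closedNbhd E′ _ ∘ q⊆p∪q S₀ (e - u))

  removalBounds : {k k′ : ℕ} → IsHypergraph E → e ∈ₗ E → IsGammaPI E k → IsGammaPI E′ k′ →
                  (k ≤ k′ + 1) × (k′ + 1 ≤ k + ∣ e ∣)
  removalBounds (edgesNonempty , _) e∈E ((S₀ , dom , refl) , minimal) ((S₀′ , dom′ , refl) , minimal′) =
    lower , upper
    where
    e≠∅ : Nonempty e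
    e≠∅ = All.lookup edgesNonempty e∈E

    lower : ∣ S₀ ∣ ≤ ∣ S₀′ ∣ + 1
    lower = ≤-trans (minimal _ (addVertex e∈E (proj₂ e≠∅) dom′)) (∣p∪⁅x⁆∣≤∣p∣+1 S₀′ (proj₁ e≠∅))

    upper : ∣ S₀′ ∣ + 1 ≤ ∣ S₀ ∣ + ∣ e ∣
    upper with addEdgeButOne e≠∅ dom
    ... | u , u∈e , dom″ = ≤-trans (+-monoˡ-≤ 1 (minimal′ _ dom″)) (∣p∪[q-x]∣<∣p∣+∣q∣ S₀ e u∈e)

module Certificates {n : ℕ} (E : EdgeList n) where

  Stalled : Subset n → Set
  Stalled C = ∀ {C′} → Step E C C′ → C′ ⊆ C

  stalled-trap : {C S : Subset n} → Stalled C → S ⊆ C → Star (Step E) S ⊤ → ⊤ ⊆ C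
  stalled-trap stalled S⊆C ε = S⊆C
  stalled-trap {C} stalled S⊆C ((A , f , A≠∅ , A⊆S , f∈E , A⊆f , forced , refl) ◅ run) =
    stalled-trap stalled (∪-least S⊆C f⊆C) run
    where
    f⊆C : f ⊆ C
    f⊆C = stalled (liftStep inj₁ S⊆C A≠∅ A⊆S f∈E A⊆f forced) ∘ q⊆p∪q C f

  -- A decidable reason why the edge f can never be added from C: it is already
  -- inside C, it misses C, or some edge through C ∩ f reaches a vertex outside
  -- C ∪ f, which any trigger A ⊆ C ∩ f would have to force into f.
  Blocked : Subset n → Subset n → Set
  Blocked C f = f ⊆ C ⊎ Empty (C ∩ f) ⊎ Any (λ g → C ∩ f ⊆ g × Nonempty (g ∩ ∁ (C ∪ f))) E

  blocked? : (C f : Subset n) → Dec (Blocked C f)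
  blocked? C f = f ⊆? C ⊎-dec ¬? (nonempty? (C ∩ f))
                   ⊎-dec any? (λ g → (C ∩ f ⊆? g) ×-dec nonempty? (g ∩ ∁ (C ∪ f))) E

  allBlocked⇒stalled : {C : Subset n} → All (Blocked C) E → Stalled C
  allBlocked⇒stalled {C} blocked (A , f , (a , a∈A) , A⊆C , f∈E , A⊆f , forced , refl) =
    ∪-least (λ x∈ → x∈) f⊆C
    where
    a∈C∩f : a ∈ C ∩ f
    a∈C∩f = x∈p∩q⁺ (A⊆C a∈A , A⊆f a∈A)

    f⊆C : f ⊆ C
    f⊆C with All.lookup blocked f∈E
    ... | inj₁ f⊆C          = f⊆C
    ... | inj₂ (inj₁ empty) = ⊥-elim (empty (a , a∈C∩f))
    ... | inj₂ (inj₂ escape) with find escape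
    ...   | g , g∈E , C∩f⊆g , v , v∈g∖C∪f = ⊥-elim (v∉C∪f (q⊆p∪q C f v∈f))
      where
      v∉C∪f : v ∉ C ∪ f
      v∉C∪f = x∈∁p⇒x∉p (proj₂ (x∈p∩q⁻ g _ v∈g∖C∪f))

      v∈f : v ∈ f
      v∈f = forced v (v∉C∪f ∘ p⊆p∪q f)
              (g , g∈E , (λ x∈A → C∩f⊆g (x∈p∩q⁺ (A⊆C x∈A , A⊆f x∈A))) , proj₁ (x∈p∩q⁻ g _ v∈g∖C∪f))

  -- C certifies that no subset of X is an infectious power dominating set.
  Certificate : Subset n → Subset n → Set
  Certificate X C = closedNbhd E X ⊆ C × All (Blocked C) E × ¬ (⊤ ⊆ C)

  certificate? : (X C : Subset n) → Dec (Certificate X C)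
  certificate? X C = (closedNbhd E X ⊆? C) ×-dec All.all? (blocked? C) E ×-dec ¬? (⊤ ⊆? C)

  certificate⇒notIPDS : {X C S₀ : Subset n} → Certificate X C → S₀ ⊆ X → ¬ IsIPDS E S₀
  certificate⇒notIPDS (N[X]⊆C , blocked , C≠⊤) S₀⊆X dom =
    C≠⊤ (stalled-trap (allBlocked⇒stalled blocked) (N[X]⊆C ∘ N[S₀]⊆N[X]) dom)
    where
    N[S₀]⊆N[X] : closedNbhd E _ ⊆ closedNbhd E _
    N[S₀]⊆N[X] = closedNbhd-transfer {F = E} {G = E} S₀⊆X (λ g∈ _ → inj₁ g∈)

  twoOrMore : (x₀ : Fin n) (cert : Fin n → Subset n) → (∀ x → Certificate ⁅ x ⁆ (cert x)) →
              {S₀ : Subset n} → IsIPDS E S₀ → 2 ≤ ∣ S₀ ∣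
  twoOrMore x₀ cert certified {S₀} dom with 2 ≤? ∣ S₀ ∣
  ... | yes 2≤ = 2≤
  ... | no  2≰ with ⊆-singleton x₀ S₀ (≤-pred (≰⇒> 2≰))
  ...   | x , S₀⊆⁅x⁆ = ⊥-elim (certificate⇒notIPDS (certified x) S₀⊆⁅x⁆ dom)

  -- A decidable sufficient condition for a step with a single trigger vertex x:
  -- every edge through x lies in S ∪ f, so f contains every uninfected neighbour of x.
  SingleStep : Subset n → Fin n → Subset n → Set
  SingleStep S x f = x ∈ S × x ∈ f × All (λ g → x ∈ g → g ⊆ S ∪ f) E

  singleStep? : (S : Subset n) (x : Fin n) (f : Subset n) → Dec (SingleStep S x f)
  singleStep? S x f = (x ∈? S) ×-dec (x ∈? f) ×-dec All.all? (λ g → (x ∈? g) →-dec (g ⊆? S ∪ f)) E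

  singleStep : {S f : Subset n} (x : Fin n) → f ∈ₗ E → SingleStep S x f → Step E S (S ∪ f)
  singleStep {S} {f} x f∈E (x∈S , x∈f , edgesThroughx) =
    ⁅ x ⁆ , f , (x , x∈⁅x⁆ x) , ⁅⁆⊆ x∈S , f∈E , ⁅⁆⊆ x∈f , forced , refl
    where
    forced : Forced E S ⁅ x ⁆ f
    forced v v∉S (g , g∈E , ⁅x⁆⊆g , v∈g) with x∈p∪q⁻ S f (All.lookup edgesThroughx g∈E (⁅x⁆⊆g (x∈⁅x⁆ x)) v∈g)
    ... | inj₁ v∈S = ⊥-elim (v∉S v∈S)
    ... | inj₂ v∈f = v∈f

module _ {m : ℕ} (E : EdgeList (suc m)) where
  open Certificates E

  ∅-stalled : Stalled ⊥
  ∅-stalled (A , _ , (a , a∈A) , A⊆⊥ , _) = ⊥-elim (∉⊥ (A⊆⊥ a∈A))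

  oneOrMore : {S₀ : Subset (suc m)} → IsIPDS E S₀ → 1 ≤ ∣ S₀ ∣
  oneOrMore {S₀} dom with nonempty? S₀
  ... | yes (x , x∈S₀) = ∈⇒1≤∣∣ x∈S₀
  ... | no  empty      = ⊥-elim (∉⊥ (stalled-trap ∅-stalled N[∅]⊆∅ dom′ (∈⊤ {x = zero})))
    where
    dom′ : IsIPDS E ⊥
    dom′ = subst (IsIPDS E) (Empty-unique empty) dom

    N[∅]⊆∅ : closedNbhd E ⊥ ⊆ ⊥
    N[∅]⊆∅ = closedNbhd-least E (λ x∈ → x∈) λ _ (x , x∈g∩⊥) → ⊥-elim (∉⊥ (proj₂ (x∈p∩q⁻ _ ⊥ x∈g∩⊥)))

edgeless-IPDS : {n : ℕ} {S₀ : Subset n} → IsIPDS [] S₀ → S₀ ≡ ⊤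
edgeless-IPDS ε = refl
edgeless-IPDS ((_ , _ , _ , _ , () , _) ◅ _)

HypergraphCheck : {n : ℕ} → EdgeList n → Set
HypergraphCheck E = All Nonempty E × All (λ a → All (λ b → a ≡ b ⊎ ¬ a ⊆ b) E) E

hypergraphCheck? : {n : ℕ} (E : EdgeList n) → Dec (HypergraphCheck E)
hypergraphCheck? E = All.all? nonempty? E
  ×-dec All.all? (λ a → All.all? (λ b → ≡-dec Bool._≟_ a b ⊎-dec ¬? (a ⊆? b)) E) E

checked⇒hypergraph : {n : ℕ} {E : EdgeList n} → HypergraphCheck E → IsHypergraph E
checked⇒hypergraph (nonempty , comparable) = nonempty , reduced
  where
  reduced : ∀ {a b} → a ∈ₗ _ → b ∈ₗ _ → a ⊆ b → a ≡ b
  reduced a∈ b∈ a⊆b with All.lookup (All.lookup comparable a∈) b∈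
  ... | inj₁ a≡b = a≡b
  ... | inj₂ a⊈b = ⊥-elim (a⊈b a⊆b)

-- The lower bound is attained: a graph on six vertices with γ(H) = 2 but γ(H - e) = 1.
-- In H - e the vertex 0 dominates 1, 2, 4; then 1 forces 3 and 3 forces 5.
-- With the extra edge e = {1,5}, vertex 1 has two uninfected neighbours and the
-- propagation from any single vertex stalls.
module LowerBoundAttained where

  vertices : List (Fin 6) → Subset 6
  vertices = foldr (λ x S → ⁅ x ⁆ ∪ S) ⊥

  e : Subset 6
  e = vertices (# 1 ∷ # 5 ∷ [])

  E : EdgeList 6
  E = vertices (# 0 ∷ # 2 ∷ []) ∷ vertices (# 0 ∷ # 1 ∷ []) ∷ vertices (# 0 ∷ # 4 ∷ [])
    ∷ e ∷ vertices (# 3 ∷ # 5 ∷ []) ∷ vertices (# 1 ∷ # 3 ∷ []) ∷ []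

  open Removal E e using (E′)

  -- For each single starting vertex, a stalled set containing its neighbourhood.
  stall : Fin 6 → Subset 6
  stall = lookup ( vertices (# 0 ∷ # 1 ∷ # 2 ∷ # 4 ∷ []) ∷ vertices (# 0 ∷ # 1 ∷ # 3 ∷ # 5 ∷ [])
                 ∷ vertices (# 0 ∷ # 2 ∷ [])             ∷ vertices (# 0 ∷ # 1 ∷ # 3 ∷ # 5 ∷ [])
                 ∷ vertices (# 0 ∷ # 4 ∷ [])             ∷ vertices (# 0 ∷ # 1 ∷ # 3 ∷ # 5 ∷ []) ∷ [])

  γH : IsGammaPI E 2
  γH = (vertices (# 0 ∷ # 1 ∷ []) , ε , refl) ,
       λ S₀ → Certificates.twoOrMore E (# 0) stall
                (toWitness {a? = all? (λ x → Certificates.certificate? E ⁅ x ⁆ (stall x))} tt) {S₀}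

  γH-e : IsGammaPI E′ 1
  γH-e = (⁅ # 0 ⁆ , force3 ◅ force5 ◅ ε , refl) , λ S₀ → oneOrMore E′ {S₀}
    where
    open Certificates E′ using (singleStep; singleStep?)
    N₀ = closedNbhd E′ ⁅ # 0 ⁆
    force3 = singleStep (# 1) (there (there (there (there (here refl)))))
               (toWitness {a? = singleStep? N₀ (# 1) (vertices (# 1 ∷ # 3 ∷ []))} tt)
    force5 = singleStep (# 3) (there (there (there (here refl))))
               (toWitness {a? = singleStep? (N₀ ∪ vertices (# 1 ∷ # 3 ∷ [])) (# 3) (vertices (# 3 ∷ # 5 ∷ []))} tt)

  attained : Σ ℕ λ n → Σ (EdgeList n) λ E → Σ (Subset n) λ e → Σ ℕ λ k → Σ ℕ λ k′ →
             IsHypergraph E × e ∈ₗ E × IsGammaPI E k × IsGammaPI (removeEdge E e) k′ × k ≡ k′ + 1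
  attained = 6 , E , e , 2 , 1 ,
    checked⇒hypergraph (toWitness {a? = hypergraphCheck? E} tt) ,
    there (there (there (here refl))) , γH , γH-e , refl

module UpperBoundAttained where

  E : EdgeList 2
  E = ⊤ ∷ []

  γH : IsGammaPI E 1
  γH = (⁅ zero ⁆ , ε , refl) , λ S₀ → oneOrMore E {S₀}

  γH-e : IsGammaPI (removeEdge E ⊤) 2
  γH-e = (⊤ , ε , refl) , minimal
    where
    minimal : (S₀ : Subset 2) → IsIPDS [] S₀ → 2 ≤ ∣ S₀ ∣
    minimal S₀ dom with edgeless-IPDS dom
    ... | refl = s≤s (s≤s z≤n)

  attained : Σ ℕ λ n → Σ (EdgeList n) λ E → Σ (Subset n) λ e → Σ ℕ λ k → Σ ℕ λ k′ →
             IsHypergraph E × e ∈ₗ E × IsGammaPI E k × IsGammaPI (removeEdge E e) k′ ×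
             k′ + 1 ≡ k + ∣ e ∣
  attained = 2 , E , ⊤ , 1 , 2 ,
    checked⇒hypergraph (toWitness {a? = hypergraphCheck? E} tt) , here refl , γH , γH-e , refl

theorem6p1 :
    ((n : ℕ) (E : EdgeList n) (e : Subset n) (k k′ : ℕ) →
      IsHypergraph E → e ∈ₗ E →
      IsGammaPI E k → IsGammaPI (removeEdge E e) k′ →
      (k ≤ k′ + 1) × (k′ + 1 ≤ k + ∣ e ∣))
    ×
    (Σ ℕ λ n → Σ (EdgeList n) λ E → Σ (Subset n) λ e → Σ ℕ λ k → Σ ℕ λ k′ →
      IsHypergraph E × e ∈ₗ E × IsGammaPI E k × IsGammaPI (removeEdge E e) k′ ×
      k ≡ k′ + 1)
    ×
    (Σ ℕ λ n → Σ (EdgeList n) λ E → Σ (Subset n) λ e → Σ ℕ λ k → Σ ℕ λ k′ →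
      IsHypergraph E × e ∈ₗ E × IsGammaPI E k × IsGammaPI (removeEdge E e) k′ ×
      k′ + 1 ≡ k + ∣ e ∣)
theorem6p1 =
  (λ n E e k k′ → Removal.removalBounds E e) ,
  LowerBoundAttained.attained ,
  UpperBoundAttained.attained
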